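{- Let $\alpha\in(0,1)$ be irrational and let $B_1,B_2,\dots$ be the Minkowski chain of $\alpha$ (case $n=1$, defined in the context). Then $|\det B_k|=1$ for all $k\ge1$.
   Context: Minkowski chain for $n=1$, $\ell=2$: for $w=(w_1,w_2)\in\mathbb{Z}^2$ put $\xi(w)=w_2+\alpha w_1$. For $m\in\mathbb{Z}^+$ define the $2\times2$ integer matrix $A_m$ with rows $w_1,w_2$: $w_1$ is the nonzero $w\in\mathbb{Z}^2$ with $\|w\|_\infty\le m$ minimizing $|\xi(w)|$, and $w_2$ is the $w\in\mathbb{Z}^2$ with $\|w\|_\infty\le m$, linearly independent of $w_1$, minimizing $|\xi(w)|$; each normalized so its first nonzero entry is positive (unique since $\alpha$ is irrational). The Minkowski chain $B_1,B_2,\dots$ is the sequence of distinct matrices among $A_1,A_2,\dots$ in order of first appearance. -}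

module Defs where

open import Data.Nat as ℕ using (ℕ; zero; suc)
open import Data.Integer as ℤ using (ℤ; +_; -[1+_]; +[1+_])
open import Data.Rational as ℚ using (ℚ)
open import Data.Product using (Σ; ∃; _×_; _,_)
open import Data.Sum using (_⊎_)
open import Data.Empty using (⊥)
open import Relation.Nullary using (¬_)
open import Relation.Binary.PropositionalEquality using (_≡_; _≢_)

-- An irrational real number α ∈ (0,1), given as a Dedekind cut (L , U)
-- on ℚ:  L q  means  q < α,  U q  means  α < q.
-- Irrationality: every rational lies strictly on one side (total).

record IrrationalIn01 : Set₁ where
  field
    L : ℚ → Set
    U : ℚ → Set
    disjoint : ∀ q → L q → U q → ⊥
    total    : ∀ q → L q ⊎ U q
    L-down   : ∀ p q → p ℚ.< q → L q → L p
    U-up     : ∀ p q → p ℚ.< q → U p → U q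
    L-open   : ∀ q → L q → ∃ λ r → q ℚ.< r × L r
    U-open   : ∀ q → U q → ∃ λ r → r ℚ.< q × U r
    zero<α   : L ℚ.0ℚ
    α<one    : U ℚ.1ℚ

open IrrationalIn01 public

-- Integer vectors w = (w₁ , w₂) ∈ ℤ², and ξ(w) = w₂ + α w₁.

Vec2 : Set
Vec2 = ℤ × ℤ

fst snd : Vec2 → ℤ
fst (a , _) = a
snd (_ , b) = b

zeroV : Vec2
zeroV = (+ 0 , + 0)

_-V_ : Vec2 → Vec2 → Vec2
(a , b) -V (c , d) = (a ℤ.- c , b ℤ.- d)

negV : Vec2 → Vec2
negV (a , b) = (ℤ.- a , ℤ.- b)

-- ξ(w) > 0, i.e.  w₂ + α w₁ > 0, read off from the cut.
ξPos : IrrationalIn01 → Vec2 → Set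
ξPos α (+ 0 , b)        = + 0 ℤ.< b
ξPos α (+[1+ n ] , b)   = L α ((ℤ.- b) ℚ./ suc n)
ξPos α (-[1+ n ] , b)   = U α (b ℚ./ suc n)

ξNonNeg : IrrationalIn01 → Vec2 → Set
ξNonNeg α v = ξPos α v ⊎ v ≡ zeroV

-- v represents |ξ(w)|:  v = ±w and ξ(v) ≥ 0, so ξ(v) = |ξ(w)|.
IsAbs : IrrationalIn01 → Vec2 → Vec2 → Set
IsAbs α w v = (v ≡ w ⊎ v ≡ negV w) × ξNonNeg α v

AbsLt : IrrationalIn01 → Vec2 → Vec2 → Set
AbsLt α w w' = ∀ v v' → IsAbs α w v → IsAbs α w' v' → ξPos α (v' -V v)

AbsLe : IrrationalIn01 → Vec2 → Vec2 → Set
AbsLe α w w' = ¬ AbsLt α w' w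

NormLe : Vec2 → ℕ → Set
NormLe (a , b) m = ℤ.∣ a ∣ ℕ.≤ m × ℤ.∣ b ∣ ℕ.≤ m

Normalized : Vec2 → Set
Normalized (a , b) = + 0 ℤ.< a ⊎ (a ≡ + 0 × + 0 ℤ.< b)

LinIndep : Vec2 → Vec2 → Set
LinIndep (a , b) (c , d) =
  ∀ (x y : ℤ) → x ℤ.* a ℤ.+ y ℤ.* c ≡ + 0 → x ℤ.* b ℤ.+ y ℤ.* d ≡ + 0 →
  x ≡ + 0 × y ≡ + 0

-- 2×2 integer matrices, given by their rows.

Mat2 : Set
Mat2 = Vec2 × Vec2

det : Mat2 → ℤ
det ((a , b) , (c , d)) = a ℤ.* d ℤ.- b ℤ.* c

IsA : IrrationalIn01 → ℕ → Mat2 → Set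
IsA α m (w₁ , w₂) =
  (w₁ ≢ zeroV × NormLe w₁ m × Normalized w₁ ×
     (∀ w → w ≢ zeroV → NormLe w m → AbsLe α w₁ w))
  ×
  (LinIndep w₁ w₂ × NormLe w₂ m × Normalized w₂ ×
     (∀ w → LinIndep w₁ w → NormLe w m → AbsLe α w₂ w))

-- B (0-indexed: B k is B_{k+1} of the paper) is the sequence of distinct
-- values of A (over m ≥ 1) in order of first appearance; s k is the
-- index of first appearance of B k.
IsChainOf : (ℕ → Mat2) → (ℕ → Mat2) → Set
IsChainOf A B =
  Σ (ℕ → ℕ) λ s →
    (s 0 ≡ 1) ×
    (∀ k → s k ℕ.< s (suc k)) ×
    (∀ k → B k ≡ A (s k)) ×
    (∀ k m → 1 ℕ.≤ m → m ℕ.< s k → A m ≢ A (s k)) ×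
    (∀ m → 1 ℕ.≤ m → ∃ λ k → s k ℕ.≤ m × A m ≡ B k)

module Submission where

-- Each B_k is some A_m with m ≥ 1, so it suffices that |det A_m| = 1.  Let
-- w₁ = (a , b), w₂ = (c , d) be the rows and D = det A_m; independence gives
-- D ≠ 0.  If |D| ≥ 2, reducing the adjugate relations D·e₁ = d·w₁ - b·w₂ and
-- D·e₂ = -c·w₁ + a·w₂ modulo D yields u ∈ ℤ² with D·u = x·w₁ + y·w₂,
-- (x , y) ≠ 0 and |x|, |y| ≤ |D|/2.  Then ‖u‖∞ ≤ m and
-- |D|·|ξ(u)| ≤ |x|·|ξ(w₁)| + |y|·|ξ(w₂)|.  Since |ξ(w₁)| < |ξ(w₂)| (strict by
-- irrationality), |ξ(u)| < |ξ(w₂)|, and |ξ(u)| < |ξ(w₁)| when y = 0.  As u is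
-- independent of w₁ when y ≠ 0 and nonzero when y = 0, this contradicts the
-- choice of w₂ or of w₁.

open import Defs
open import Data.Nat as ℕ using (ℕ; zero; suc)
import Data.Nat.Properties as ℕP
open import Data.Integer as ℤ using (ℤ; +_; -[1+_]; +[1+_]; _*_; _+_; _-_; -_; ∣_∣)
import Data.Integer.Properties as ℤP
open import Data.Integer.DivMod using (a≡a%n+[a/n]*n; n%d<d)
open import Data.Integer.Tactic.RingSolver using (solve-∀; solve)
import Data.Nat.Tactic.RingSolver as NatSolver
open import Data.Rational as ℚ using (ℚ; ↥_; ↧_)
import Data.Rational.Properties as ℚP
import Data.Rational.Unnormalised as ℚᵘ
import Data.Rational.Unnormalised.Properties as ℚᵘP
open import Data.List using (_∷_; [])
open import Data.Product using (Σ; _×_; _,_; proj₁; proj₂)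
open import Data.Sum using (_⊎_; inj₁; inj₂)
open import Data.Empty using (⊥; ⊥-elim)
open import Relation.Nullary using (¬_; Dec; yes; no)
open import Relation.Binary using (tri<; tri≈; tri>)
open import Relation.Binary.PropositionalEquality
open import Function using (_∘_)

infixl 6 _+V_
infixr 7 _·V_

_+V_ : Vec2 → Vec2 → Vec2
(a , b) +V (c , d) = (a + c , b + d)

_·V_ : ℤ → Vec2 → Vec2
k ·V (a , b) = (k * a , k * b)

negV-involutive : ∀ v → negV (negV v) ≡ v
negV-involutive (a , b) = cong₂ _,_ (ℤP.neg-involutive a) (ℤP.neg-involutive b)

·V-assoc : ∀ k l v → k ·V (l ·V v) ≡ (k * l) ·V v
·V-assoc k l (a , b) = cong₂ _,_ (sym (ℤP.*-assoc k l a)) (sym (ℤP.*-assoc k l b))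

·V-identity : ∀ v → + 1 ·V v ≡ v
·V-identity (a , b) = cong₂ _,_ (ℤP.*-identityˡ a) (ℤP.*-identityˡ b)

-1·V : ∀ v → -[1+ 0 ] ·V v ≡ negV v
-1·V (a , b) = cong₂ _,_ (ℤP.-1*i≡-i a) (ℤP.-1*i≡-i b)

negV-diff : ∀ v w → negV (v -V w) ≡ w -V v
negV-diff (a , b) (c , d) = cong₂ _,_ (flip a c) (flip b d)
  where
  flip : ∀ a c → - (a - c) ≡ c - a
  flip = solve-∀

diff≡0 : ∀ v w → v -V w ≡ zeroV → v ≡ w
diff≡0 (a , b) (c , d) e = cong₂ _,_ (ℤP.i-j≡0⇒i≡j a c (cong proj₁ e)) (ℤP.i-j≡0⇒i≡j b d (cong proj₂ e))

<⇒0<- : ∀ {i j} → i ℤ.< j → + 0 ℤ.< j - i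
<⇒0<- {i} {j} i<j = subst (ℤ._< j - i) (ℤP.+-inverseʳ i) (ℤP.+-monoˡ-< (- i) i<j)

0<-⇒< : ∀ {i j} → + 0 ℤ.< j - i → i ℤ.< j
0<-⇒< {i} {j} h = subst₂ ℤ._<_ (ℤP.+-identityˡ i) j-i+i≡j (ℤP.+-monoˡ-< i h)
  where
  j-i+i≡j : j - i + i ≡ j
  j-i+i≡j = solve (i ∷ j ∷ [])

*-pos : ∀ {i j} → + 0 ℤ.< i → + 0 ℤ.< j → + 0 ℤ.< i * j
*-pos {i} {j} 0<i 0<j = subst (ℤ._< i * j) (ℤP.*-zeroʳ i) (ℤP.*-monoˡ-<-pos i {{ℤ.positive 0<i}} 0<j)

*-pos-cancel : ∀ {i j} → + 0 ℤ.< i → + 0 ℤ.< i * j → + 0 ℤ.< j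
*-pos-cancel {i} {j} 0<i h =
  ℤP.*-cancelˡ-<-nonNeg i {{ℤ.nonNegative (ℤP.<⇒≤ 0<i)}} (subst (ℤ._< i * j) (sym (ℤP.*-zeroʳ i)) h)

↧-pos : ∀ t → + 0 ℤ.< ↧ t
↧-pos (ℚ.mkℚ _ _ _) = ℤ.+<+ (ℕ.s≤s ℕ.z≤n)

/-unnormalised : ∀ i n → ℚ.toℚᵘ (i ℚ./ suc n) ℚᵘ.≃ ℚᵘ.mkℚᵘ i n
/-unnormalised i n = ℚP.toℚᵘ-fromℚᵘ (ℚᵘ.mkℚᵘ i n)

<-/⇒ : ∀ t i n → t ℚ.< i ℚ./ suc n → ↥ t * + suc n ℤ.< i * ↧ t
<-/⇒ t@record{} i n h with ℚᵘP.<-respʳ-≃ (/-unnormalised i n) (ℚP.toℚᵘ-mono-< h)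
... | ℚᵘ.*<* lt = lt

<-/⇐ : ∀ t i n → ↥ t * + suc n ℤ.< i * ↧ t → t ℚ.< i ℚ./ suc n
<-/⇐ t@record{} i n h =
  ℚP.toℚᵘ-cancel-< (ℚᵘP.<-respʳ-≃ (ℚᵘP.≃-sym (/-unnormalised i n)) (ℚᵘ.*<* h))

/-<⇒ : ∀ t i n → i ℚ./ suc n ℚ.< t → i * ↧ t ℤ.< ↥ t * + suc n
/-<⇒ t@record{} i n h with ℚᵘP.<-respˡ-≃ (/-unnormalised i n) (ℚP.toℚᵘ-mono-< h)
... | ℚᵘ.*<* lt = lt

/-<⇐ : ∀ t i n → i * ↧ t ℤ.< ↥ t * + suc n → i ℚ./ suc n ℚ.< t
/-<⇐ t@record{} i n h =
  ℚP.toℚᵘ-cancel-< (ℚᵘP.<-respˡ-≃ (ℚᵘP.≃-sym (/-unnormalised i n)) (ℚᵘ.*<* h))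

-- As ξ(v) = a·α + b, the
-- sign of ξ(v) is the sign of this form near α.

PosAt : Vec2 → ℚ → Set
PosAt (a , b) t = + 0 ℤ.< a * ↥ t + b * ↧ t

PosAt-+ : ∀ v w t → PosAt v t → PosAt w t → PosAt (v +V w) t
PosAt-+ (a , b) (c , d) t p q = subst (+ 0 ℤ.<_) (sym (split a b c d (↥ t) (↧ t))) (ℤP.+-mono-< p q)
  where
  split : ∀ a b c d p q → (a + c) * p + (b + d) * q ≡ (a * p + b * q) + (c * p + d * q)
  split = solve-∀

PosAt-shift : ∀ a b p q p' q' → + 0 ℤ.< q → + 0 ℤ.< q' → a * p' * q ℤ.≤ a * p * q' →
  + 0 ℤ.< a * p' + b * q' → + 0 ℤ.< a * p + b * q
PosAt-shift a b p q p' q' 0<q 0<q' le pos = *-pos-cancel 0<q' (begin-strict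
  + 0                        <⟨ *-pos 0<q pos ⟩
  q * (a * p' + b * q')      ≡⟨ solve (a ∷ b ∷ p' ∷ q ∷ q' ∷ []) ⟩
  a * p' * q + b * (q * q')  ≤⟨ ℤP.+-monoˡ-≤ (b * (q * q')) le ⟩
  a * p * q' + b * (q * q')  ≡⟨ solve (a ∷ b ∷ p ∷ q ∷ q' ∷ []) ⟩
  q' * (a * p + b * q)       ∎)
  where open ℤP.≤-Reasoning

PosAt-convex : ∀ v {t₁ t t₂} → t₁ ℚ.≤ t → t ℚ.≤ t₂ → PosAt v t₁ → PosAt v t₂ → PosAt v t
PosAt-convex (a , b) {t₁} {t} {t₂} t₁≤t t≤t₂ p₁ p₂ with ℤP.≤-total (+ 0) a
... | inj₁ 0≤a = PosAt-shift a b (↥ t) (↧ t) (↥ t₁) (↧ t₁) (↧-pos t) (↧-pos t₁)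
      (subst₂ ℤ._≤_ (sym (ℤP.*-assoc a (↥ t₁) (↧ t))) (sym (ℤP.*-assoc a (↥ t) (↧ t₁)))
        (ℤP.*-monoˡ-≤-nonNeg a {{ℤ.nonNegative 0≤a}} (ℚP.drop-*≤* t₁≤t))) p₁
... | inj₂ a≤0 = PosAt-shift a b (↥ t) (↧ t) (↥ t₂) (↧ t₂) (↧-pos t) (↧-pos t₂)
      (subst₂ ℤ._≤_ (sym (ℤP.*-assoc a (↥ t₂) (↧ t))) (sym (ℤP.*-assoc a (↥ t) (↧ t₂)))
        (ℤP.*-monoˡ-≤-nonPos a {{ℤ.nonPositive a≤0}} (ℚP.drop-*≤* t≤t₂))) p₂

-- For first coordinate ±(n+1) the form changes sign exactly at its root
-- ∓b/(n+1); these are the cross-multiplied forms of that statement.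

above-root : ∀ p q s b → p * s - (- b) * q ≡ s * p + b * q
above-root = solve-∀

below-root : ∀ p q s b → b * q - p * s ≡ (- s) * p + b * q
below-root = solve-∀

root<⇒PosAt : ∀ n b t → (- b) ℚ./ suc n ℚ.< t → PosAt (+[1+ n ] , b) t
root<⇒PosAt n b t h = subst (+ 0 ℤ.<_) (above-root (↥ t) (↧ t) (+ suc n) b) (<⇒0<- (/-<⇒ t (- b) n h))

PosAt⇒root< : ∀ n b t → PosAt (+[1+ n ] , b) t → (- b) ℚ./ suc n ℚ.< t
PosAt⇒root< n b t h = /-<⇐ t (- b) n (0<-⇒< (subst (+ 0 ℤ.<_) (sym (above-root (↥ t) (↧ t) (+ suc n) b)) h))

<root⇒PosAt : ∀ n b t → t ℚ.< b ℚ./ suc n → PosAt (-[1+ n ] , b) t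
<root⇒PosAt n b t h = subst (+ 0 ℤ.<_) (below-root (↥ t) (↧ t) (+ suc n) b) (<⇒0<- (<-/⇒ t b n h))

PosAt⇒<root : ∀ n b t → PosAt (-[1+ n ] , b) t → t ℚ.< b ℚ./ suc n
PosAt⇒<root n b t h = <-/⇐ t b n (0<-⇒< (subst (+ 0 ℤ.<_) (sym (below-root (↥ t) (↧ t) (+ suc n) b)) h))

PosAt-const : ∀ b t → PosAt (+ 0 , b) t → + 0 ℤ.< b
PosAt-const b t h = *-pos-cancel (↧-pos t)
  (subst (+ 0 ℤ.<_) (trans (ℤP.+-identityˡ (b * ↧ t)) (ℤP.*-comm b (↧ t))) h)

const-PosAt : ∀ b t → + 0 ℤ.< b → PosAt (+ 0 , b) t
const-PosAt b t h = subst (+ 0 ℤ.<_) (trans (ℤP.*-comm (↧ t) b) (sym (ℤP.+-identityˡ (b * ↧ t))))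
  (*-pos (↧-pos t) h)

module SignOfξ (α : IrrationalIn01) where

  L<U : ∀ {p q} → L α p → U α q → p ℚ.< q
  L<U {p} {q} lp uq with ℚP.<-cmp p q
  ... | tri< p<q _ _ = p<q
  ... | tri≈ _ refl _ = ⊥-elim (disjoint α p lp uq)
  ... | tri> _ _ q<p = ⊥-elim (disjoint α q (L-down α q p q<p lp) uq)

  Bracketed : Vec2 → Set
  Bracketed v = Σ ℚ λ l → Σ ℚ λ u → L α l × U α u × PosAt v l × PosAt v u

  -- ξ(v) > 0 iff v is bracketed: the root of the form lies on the correct
  -- side of α, and the cut is open.
  ξPos⇒Bracketed : ∀ v → ξPos α v → Bracketed v
  ξPos⇒Bracketed (+ zero , b) 0<b =
    ℚ.0ℚ , ℚ.1ℚ , zero<α α , α<one α , const-PosAt b ℚ.0ℚ 0<b , const-PosAt b ℚ.1ℚ 0<b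
  ξPos⇒Bracketed (+[1+ n ] , b) root<α with L-open α _ root<α
  ... | l , root<l , Ll = l , ℚ.1ℚ , Ll , α<one α ,
        root<⇒PosAt n b l root<l , root<⇒PosAt n b ℚ.1ℚ (L<U root<α (α<one α))
  ξPos⇒Bracketed (-[1+ n ] , b) α<root with U-open α _ α<root
  ... | u , u<root , Uu = ℚ.0ℚ , u , zero<α α , Uu ,
        <root⇒PosAt n b ℚ.0ℚ (L<U (zero<α α) α<root) , <root⇒PosAt n b u u<root

  Bracketed⇒ξPos : ∀ v → Bracketed v → ξPos α v
  Bracketed⇒ξPos (+ zero , b) (l , _ , _ , _ , pl , _) = PosAt-const b l pl
  Bracketed⇒ξPos (+[1+ n ] , b) (l , _ , Ll , _ , pl , _) = L-down α _ l (PosAt⇒root< n b l pl) Ll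
  Bracketed⇒ξPos (-[1+ n ] , b) (_ , u , _ , Uu , _ , pu) = U-up α u _ (PosAt⇒<root n b u pu) Uu

  L-⊔ : ∀ {p q} → L α p → L α q → L α (p ℚ.⊔ q)
  L-⊔ {p} {q} lp lq with ℚP.⊔-sel p q
  ... | inj₁ eq = subst (L α) (sym eq) lp
  ... | inj₂ eq = subst (L α) (sym eq) lq

  U-⊓ : ∀ {p q} → U α p → U α q → U α (p ℚ.⊓ q)
  U-⊓ {p} {q} up uq with ℚP.⊓-sel p q
  ... | inj₁ eq = subst (U α) (sym eq) up
  ... | inj₂ eq = subst (U α) (sym eq) uq

  -- Bracketed vectors add: both forms are positive on the intersection
  -- of the two brackets.
  Bracketed-+ : ∀ v w → Bracketed v → Bracketed w → Bracketed (v +V w)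
  Bracketed-+ v w (l₁ , u₁ , L₁ , U₁ , pl₁ , pu₁) (l₂ , u₂ , L₂ , U₂ , pl₂ , pu₂) =
    l , u , Ll , Uu ,
    PosAt-+ v w l (PosAt-convex v l₁≤l (l≤ U₁) pl₁ pu₁) (PosAt-convex w l₂≤l (l≤ U₂) pl₂ pu₂) ,
    PosAt-+ v w u (PosAt-convex v (≤u L₁) u≤u₁ pl₁ pu₁) (PosAt-convex w (≤u L₂) u≤u₂ pl₂ pu₂)
    where
    l u : ℚ
    l = l₁ ℚ.⊔ l₂
    u = u₁ ℚ.⊓ u₂
    Ll : L α l
    Ll = L-⊔ L₁ L₂
    Uu : U α u
    Uu = U-⊓ U₁ U₂
    l₁≤l : l₁ ℚ.≤ l
    l₁≤l = ℚP.p≤p⊔q l₁ l₂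
    l₂≤l : l₂ ℚ.≤ l
    l₂≤l = ℚP.p≤q⊔p l₁ l₂
    u≤u₁ : u ℚ.≤ u₁
    u≤u₁ = ℚP.p⊓q≤p u₁ u₂
    u≤u₂ : u ℚ.≤ u₂
    u≤u₂ = ℚP.p⊓q≤q u₁ u₂
    l≤ : ∀ {q} → U α q → l ℚ.≤ q
    l≤ Uq = ℚP.<⇒≤ (L<U Ll Uq)
    ≤u : ∀ {q} → L α q → q ℚ.≤ u
    ≤u Lq = ℚP.<⇒≤ (L<U Lq Uu)

  ξPos-+ : ∀ v w → ξPos α v → ξPos α w → ξPos α (v +V w)
  ξPos-+ v w pv pw = Bracketed⇒ξPos (v +V w) (Bracketed-+ v w (ξPos⇒Bracketed v pv) (ξPos⇒Bracketed w pw))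

  -- Irrationality: ξ(v) vanishes only at v = 0.
  ξPos-trichotomy : ∀ v → ξPos α v ⊎ ξPos α (negV v) ⊎ v ≡ zeroV
  ξPos-trichotomy (+ zero , b) with ℤP.<-cmp (+ 0) b
  ... | tri< 0<b _ _ = inj₁ 0<b
  ... | tri≈ _ b≡0 _ = inj₂ (inj₂ (cong (+ 0 ,_) (sym b≡0)))
  ... | tri> _ _ b<0 = inj₂ (inj₁ (ℤP.neg-mono-< b<0))
  ξPos-trichotomy (+[1+ n ] , b) with total α ((- b) ℚ./ suc n)
  ... | inj₁ root<α = inj₁ root<α
  ... | inj₂ α<root = inj₂ (inj₁ α<root)
  ξPos-trichotomy (-[1+ n ] , b) with total α (b ℚ./ suc n)
  ... | inj₁ root<α = inj₂ (inj₁ (subst (λ z → L α (z ℚ./ suc n)) (sym (ℤP.neg-involutive b)) root<α))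
  ... | inj₂ α<root = inj₁ α<root

  ξPos-asym : ∀ v → ξPos α v → ξPos α (negV v) → ⊥
  ξPos-asym (+ zero , b) 0<b 0<-b = ℤP.<-asym 0<b (subst (ℤ._< + 0) (ℤP.neg-involutive b) (ℤP.neg-mono-< 0<-b))
  ξPos-asym (+[1+ n ] , b) root<α α<root = disjoint α _ root<α α<root
  ξPos-asym (-[1+ n ] , b) α<root root<α =
    disjoint α _ (subst (λ z → L α (z ℚ./ suc n)) (ℤP.neg-involutive b) root<α) α<root

-- Let Pos be the positive part of a total order on ℤ²
-- compatible with addition: closed under +, and containing exactly one of v
-- and -v for every v ≠ 0.  Then Pos is stable under positive scaling, and
-- the two averaging estimates below hold.  For Pos = {v | ξ(v) > 0} they
-- compare the values |ξ| of integer combinations.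

module PositiveCone
  (Pos : Vec2 → Set)
  (Pos-+ : ∀ v w → Pos v → Pos w → Pos (v +V w))
  (Pos-trichotomy : ∀ v → Pos v ⊎ Pos (negV v) ⊎ v ≡ zeroV)
  (Pos-asym : ∀ v → Pos v → Pos (negV v) → ⊥)
  where

  NonNeg : Vec2 → Set
  NonNeg v = Pos v ⊎ v ≡ zeroV

  Pos-zero : ¬ Pos zeroV
  Pos-zero p = Pos-asym zeroV p p

  Pos-+NonNeg : ∀ u v → Pos u → NonNeg v → Pos (u +V v)
  Pos-+NonNeg u v pu (inj₁ pv) = Pos-+ u v pu pv
  Pos-+NonNeg (a , b) v pu (inj₂ refl) = subst Pos (sym (cong₂ _,_ (ℤP.+-identityʳ a) (ℤP.+-identityʳ b))) pu

  NonNeg-+Pos : ∀ u v → NonNeg u → Pos v → Pos (u +V v)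
  NonNeg-+Pos u v (inj₁ pu) pv = Pos-+ u v pu pv
  NonNeg-+Pos u (a , b) (inj₂ refl) pv = subst Pos (sym (cong₂ _,_ (ℤP.+-identityˡ a) (ℤP.+-identityˡ b))) pv

  Pos-scale : ∀ k v → + 0 ℤ.< k → Pos v → Pos (k ·V v)
  Pos-scale (+ zero) v (ℤ.+<+ ()) p
  Pos-scale +[1+ zero ] (a , b) _ p = subst Pos (sym (cong₂ _,_ (ℤP.*-identityˡ a) (ℤP.*-identityˡ b))) p
  Pos-scale +[1+ suc n ] (a , b) _ p =
    subst Pos (sym (cong₂ _,_ (succ-* (+ suc n) a) (succ-* (+ suc n) b)))
      (Pos-+ (a , b) _ p (Pos-scale +[1+ n ] (a , b) (ℤ.+<+ (ℕ.s≤s ℕ.z≤n)) p))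
    where
    succ-* : ∀ s a → (+ 1 + s) * a ≡ a + s * a
    succ-* = solve-∀

  NonNeg-scale : ∀ k v → + 0 ℤ.≤ k → Pos v → NonNeg (k ·V v)
  NonNeg-scale (+ zero) (a , b) _ _ = inj₂ refl
  NonNeg-scale +[1+ n ] v _ p = inj₁ (Pos-scale +[1+ n ] v (ℤ.+<+ (ℕ.s≤s ℕ.z≤n)) p)

  Pos-unscale : ∀ k v → + 0 ℤ.< k → Pos (k ·V v) → Pos v
  Pos-unscale k v 0<k pkv with Pos-trichotomy v
  ... | inj₁ pv = pv
  ... | inj₂ (inj₁ p-v) = ⊥-elim (Pos-asym (k ·V v) pkv (subst Pos (scale-neg v) (Pos-scale k (negV v) 0<k p-v)))
    where
    scale-neg : ∀ v → k ·V negV v ≡ negV (k ·V v)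
    scale-neg (a , b) = cong₂ _,_ (sym (ℤP.neg-distribʳ-* k a)) (sym (ℤP.neg-distribʳ-* k b))
  ... | inj₂ (inj₂ refl) = ⊥-elim (Pos-zero (subst Pos (cong₂ _,_ (ℤP.*-zeroʳ k) (ℤP.*-zeroʳ k)) pkv))

  below-larger : ∀ E X Y r₁ r₂ r → + 0 ℤ.< E → + 2 * X ℤ.≤ E → + 2 * Y ℤ.≤ E →
    E ·V r ≡ X ·V r₁ +V Y ·V r₂ → Pos r₁ → Pos (r₂ -V r₁) → Pos (r₂ -V r)
  below-larger E X Y r₁@(a₁ , b₁) r₂@(a₂ , b₂) r@(a , b) 0<E 2X≤E 2Y≤E eq p₁ p₂₁ =
    Pos-unscale (+ 2 * E) (r₂ -V r) (*-pos {+ 2} (ℤ.+<+ (ℕ.s≤s ℕ.z≤n)) 0<E)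
      (subst Pos (cong₂ _,_ (rearrange a₁ a₂ a (cong proj₁ eq)) (rearrange b₁ b₂ b (cong proj₂ eq)))
        (NonNeg-+Pos _ _ (NonNeg-scale (E - + 2 * Y) r₂ (ℤP.i≤j⇒0≤j-i 2Y≤E) p₂)
          (Pos-+NonNeg _ _ (Pos-scale E (r₂ -V r₁) 0<E p₂₁)
                           (NonNeg-scale (E - + 2 * X) r₁ (ℤP.i≤j⇒0≤j-i 2X≤E) p₁))))
    where
    p₂ : Pos r₂
    p₂ = subst Pos (cong₂ _,_ (add-diff a₁ a₂) (add-diff b₁ b₂)) (Pos-+ r₁ (r₂ -V r₁) p₁ p₂₁)
      where
      add-diff : ∀ c₁ c₂ → c₁ + (c₂ - c₁) ≡ c₂
      add-diff = solve-∀
    rearrange : ∀ c₁ c₂ c → E * c ≡ X * c₁ + Y * c₂ →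
      (E - + 2 * Y) * c₂ + (E * (c₂ - c₁) + (E - + 2 * X) * c₁) ≡ + 2 * E * (c₂ - c)
    rearrange c₁ c₂ c h = begin
      (E - + 2 * Y) * c₂ + (E * (c₂ - c₁) + (E - + 2 * X) * c₁) ≡⟨ solve (E ∷ X ∷ Y ∷ c₁ ∷ c₂ ∷ []) ⟩
      + 2 * E * c₂ - + 2 * (X * c₁ + Y * c₂)                    ≡⟨ cong (λ z → + 2 * E * c₂ - + 2 * z) (sym h) ⟩
      + 2 * E * c₂ - + 2 * (E * c)                              ≡⟨ solve (E ∷ c₂ ∷ c ∷ []) ⟩
      + 2 * E * (c₂ - c)                                        ∎
      where open ≡-Reasoning

  below-half : ∀ E X r₁ r₂ r → + 0 ℤ.< E → + 2 * X ℤ.≤ E →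
    E ·V r ≡ X ·V r₁ +V + 0 ·V r₂ → Pos r₁ → Pos (r₁ -V r)
  below-half E X r₁@(a₁ , b₁) r₂@(a₂ , b₂) r@(a , b) 0<E 2X≤E eq p₁ =
    Pos-unscale (+ 2 * E) (r₁ -V r) (*-pos {+ 2} (ℤ.+<+ (ℕ.s≤s ℕ.z≤n)) 0<E)
      (subst Pos (cong₂ _,_ (rearrange a₁ a₂ a (cong proj₁ eq)) (rearrange b₁ b₂ b (cong proj₂ eq)))
        (Pos-+NonNeg _ _ (Pos-scale E r₁ 0<E p₁) (NonNeg-scale (E - + 2 * X) r₁ (ℤP.i≤j⇒0≤j-i 2X≤E) p₁)))
    where
    rearrange : ∀ c₁ c₂ c → E * c ≡ X * c₁ + + 0 * c₂ →
      E * c₁ + (E - + 2 * X) * c₁ ≡ + 2 * E * (c₁ - c)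
    rearrange c₁ c₂ c h = begin
      E * c₁ + (E - + 2 * X) * c₁           ≡⟨ solve (E ∷ X ∷ c₁ ∷ c₂ ∷ []) ⟩
      + 2 * E * c₁ - + 2 * (X * c₁ + + 0 * c₂) ≡⟨ cong (λ z → + 2 * E * c₁ - + 2 * z) (sym h) ⟩
      + 2 * E * c₁ - + 2 * (E * c)          ≡⟨ solve (E ∷ c₁ ∷ c ∷ []) ⟩
      + 2 * E * (c₁ - c)                    ∎
      where open ≡-Reasoning

  NonNeg-antisym : ∀ v → NonNeg v → NonNeg (negV v) → v ≡ zeroV
  NonNeg-antisym v (inj₁ p) (inj₁ q) = ⊥-elim (Pos-asym v p q)
  NonNeg-antisym (a , b) (inj₁ p) (inj₂ e) =
    trans (sym (negV-involutive (a , b))) (cong negV e)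
  NonNeg-antisym v (inj₂ e) _ = e

module Magnitude (α : IrrationalIn01) where
  open SignOfξ α public
  open PositiveCone (ξPos α) ξPos-+ ξPos-trichotomy ξPos-asym public

  IsAbs-exists : ∀ w → Σ Vec2 (IsAbs α w)
  IsAbs-exists w with ξPos-trichotomy w
  ... | inj₁ p = w , inj₁ refl , inj₁ p
  ... | inj₂ (inj₁ p) = negV w , inj₂ refl , inj₁ p
  ... | inj₂ (inj₂ w≡0) = w , inj₁ refl , inj₂ w≡0

  IsAbs-unique : ∀ {w r r'} → IsAbs α w r → IsAbs α w r' → r ≡ r'
  IsAbs-unique (inj₁ refl , _) (inj₁ refl , _) = refl
  IsAbs-unique (inj₂ refl , _) (inj₂ refl , _) = refl
  IsAbs-unique {w} (inj₁ refl , n) (inj₂ refl , n') = trans w≡0 (sym (cong negV w≡0))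
    where
    w≡0 : w ≡ zeroV
    w≡0 = NonNeg-antisym w n n'
  IsAbs-unique {w} (inj₂ refl , n) (inj₁ refl , n') = trans (cong negV w≡0) (sym w≡0)
    where
    w≡0 : w ≡ zeroV
    w≡0 = NonNeg-antisym w n' n

  IsAbs-pos : ∀ {w r} → IsAbs α w r → w ≢ zeroV → ξPos α r
  IsAbs-pos (_ , inj₁ p) _ = p
  IsAbs-pos (inj₁ refl , inj₂ r≡0) w≢0 = ⊥-elim (w≢0 r≡0)
  IsAbs-pos {w} (inj₂ refl , inj₂ r≡0) w≢0 = ⊥-elim (w≢0 (trans (sym (negV-involutive w)) (cong negV r≡0)))

  IsAbs-sign : ∀ {w r} → IsAbs α w r → Σ ℤ λ s → ∣ s ∣ ≡ 1 × w ≡ s ·V r × r ≡ s ·V w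
  IsAbs-sign {w} (inj₁ refl , _) = + 1 , refl , sym (·V-identity w) , sym (·V-identity w)
  IsAbs-sign {w} (inj₂ refl , _) = -[1+ 0 ] , refl ,
    trans (sym (negV-involutive w)) (sym (-1·V (negV w))) , sym (-1·V w)

  AbsLt-intro : ∀ {w w' r r'} → IsAbs α w r → IsAbs α w' r' → ξPos α (r' -V r) → AbsLt α w w'
  AbsLt-intro A A' p v v' Av Av' = subst₂ (λ z z' → ξPos α (z' -V z)) (IsAbs-unique A Av) (IsAbs-unique A' Av') p

LinIndep⇒¬multipleˡ : ∀ w₁ w₂ t → LinIndep w₁ w₂ → w₁ ≢ t ·V w₂
LinIndep⇒¬multipleˡ (a , b) (c , d) t ind refl with ind (+ 1) (- t) (cancel t c) (cancel t d)
  where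
  cancel : ∀ t c → + 1 * (t * c) + (- t) * c ≡ + 0
  cancel = solve-∀
... | () , _

LinIndep⇒¬multipleʳ : ∀ w₁ w₂ t → LinIndep w₁ w₂ → w₂ ≢ t ·V w₁
LinIndep⇒¬multipleʳ (a , b) (c , d) t ind refl with ind (- t) (+ 1) (cancel t a) (cancel t b)
  where
  cancel : ∀ t a → (- t) * a + + 1 * (t * a) ≡ + 0
  cancel = solve-∀
... | _ , ()

LinIndep⇒nonzeroʳ : ∀ w₁ w₂ → LinIndep w₁ w₂ → w₂ ≢ zeroV
LinIndep⇒nonzeroʳ (a , b) w₂ ind = LinIndep⇒¬multipleʳ (a , b) w₂ (+ 0) ind

-- The determinant of independent rows is nonzero: otherwise the
-- adjugate relations d·w₁ - b·w₂ = 0 and c·w₁ - a·w₂ = 0 force w₂ = 0.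
LinIndep⇒det≢0 : ∀ w₁ w₂ → LinIndep w₁ w₂ → det (w₁ , w₂) ≢ + 0
LinIndep⇒det≢0 (a , b) (c , d) ind det≡0 =
  LinIndep⇒nonzeroʳ (a , b) (c , d) ind (cong₂ _,_ (proj₁ c-a≡0) (proj₁ d-b≡0))
  where
  adj₁ : ∀ a b c d → d * a + (- b) * c ≡ a * d - b * c
  adj₁ = solve-∀
  adj₂ : ∀ a b c d → c * b + (- a) * d ≡ - (a * d - b * c)
  adj₂ = solve-∀
  cross : ∀ a b → a * b + (- b) * a ≡ + 0
  cross = solve-∀
  d-b≡0 : d ≡ + 0 × - b ≡ + 0
  d-b≡0 = ind d (- b) (trans (adj₁ a b c d) det≡0) (cross d b)
  c-a≡0 : c ≡ + 0 × - a ≡ + 0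
  c-a≡0 = ind c (- a) (cross c a) (trans (adj₂ a b c d) (cong -_ det≡0))

*≡0-cancel : ∀ {i j} → j ≢ + 0 → i * j ≡ + 0 → i ≡ + 0
*≡0-cancel {i} j≢0 ij≡0 with ℤP.i*j≡0⇒i≡0∨j≡0 i ij≡0
... | inj₁ i≡0 = i≡0
... | inj₂ j≡0 = ⊥-elim (j≢0 j≡0)

-- If D·u = x·w₁ + y·w₂ with D ≠ 0 and y ≠ 0, then u is independent of w₁:
-- a relation X·w₁ + Y·u = 0, multiplied by D, becomes the relation
-- (X·D + Y·x)·w₁ + (Y·y)·w₂ = 0 between w₁ and w₂.
combination-indep : ∀ D u x y w₁ w₂ → D ≢ + 0 → y ≢ + 0 → D ·V u ≡ x ·V w₁ +V y ·V w₂ →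
  LinIndep w₁ w₂ → LinIndep w₁ u
combination-indep D (u₁ , u₂) x y (a , b) (c , d) D≢0 y≢0 eq ind X Y h₁ h₂ = X≡0 , Y≡0
  where
  times-D : ∀ a c u₁ → D * u₁ ≡ x * a + y * c → X * a + Y * u₁ ≡ + 0 →
    (X * D + Y * x) * a + (Y * y) * c ≡ + 0
  times-D a c u₁ e h = begin
    (X * D + Y * x) * a + (Y * y) * c  ≡⟨ solve (X ∷ D ∷ Y ∷ x ∷ y ∷ a ∷ c ∷ []) ⟩
    X * D * a + Y * (x * a + y * c)    ≡⟨ cong (λ z → X * D * a + Y * z) (sym e) ⟩
    X * D * a + Y * (D * u₁)           ≡⟨ solve (X ∷ D ∷ Y ∷ a ∷ u₁ ∷ []) ⟩
    D * (X * a + Y * u₁)               ≡⟨ cong (D *_) h ⟩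
    D * + 0                            ≡⟨ ℤP.*-zeroʳ D ⟩
    + 0                                ∎
    where open ≡-Reasoning
  relation : X * D + Y * x ≡ + 0 × Y * y ≡ + 0
  relation = ind (X * D + Y * x) (Y * y) (times-D a c u₁ (cong proj₁ eq) h₁) (times-D b d u₂ (cong proj₂ eq) h₂)
  Y≡0 : Y ≡ + 0
  Y≡0 = *≡0-cancel y≢0 (proj₂ relation)
  X≡0 : X ≡ + 0
  X≡0 = *≡0-cancel D≢0 (trans (sym (ℤP.+-identityʳ (X * D)))
          (trans (cong (λ z → X * D + z * x) (sym Y≡0)) (proj₁ relation)))

combination-nonzero : ∀ D u x w₁ w₂ → w₁ ≢ zeroV → x ≢ + 0 → D ·V u ≡ x ·V w₁ +V + 0 ·V w₂ →
  u ≢ zeroV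
combination-nonzero D u x (a , b) (c , d) w₁≢0 x≢0 eq refl =
  w₁≢0 (cong₂ _,_ (component a (cong proj₁ eq)) (component b (cong proj₂ eq)))
  where
  component : ∀ a → D * + 0 ≡ x * a + + 0 → a ≡ + 0
  component a e = *≡0-cancel {a} {x} x≢0
    (trans (ℤP.*-comm a x) (trans (sym (ℤP.+-identityʳ (x * a))) (trans (sym e) (ℤP.*-zeroʳ D))))

-- Coefficients of at most half of |D| do not increase the sup-norm: if
-- D·u = x·a + y·c with 2|x|, 2|y| ≤ |D| ≠ 0 and |a|, |c| ≤ m, then |u| ≤ m,
-- since |D|·|u| ≤ |x|·|a| + |y|·|c| ≤ |D|·m.
half-coefficients-bound : ∀ D u x y a c m → D ≢ + 0 → D * u ≡ x * a + y * c →
  2 ℕ.* ∣ x ∣ ℕ.≤ ∣ D ∣ → 2 ℕ.* ∣ y ∣ ℕ.≤ ∣ D ∣ → ∣ a ∣ ℕ.≤ m → ∣ c ∣ ℕ.≤ m → ∣ u ∣ ℕ.≤ m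
half-coefficients-bound D u x y a c m D≢0 eq 2x≤D 2y≤D a≤m c≤m =
  ℕP.*-cancelˡ-≤ ∣ D ∣ {{D-nonZero}} (ℕP.*-cancelˡ-≤ 2 (begin
    2 ℕ.* (∣ D ∣ ℕ.* ∣ u ∣)                         ≡⟨ cong (2 ℕ.*_) (sym (ℤP.abs-* D u)) ⟩
    2 ℕ.* ∣ D * u ∣                                 ≡⟨ cong (λ z → 2 ℕ.* ∣ z ∣) eq ⟩
    2 ℕ.* ∣ x * a + y * c ∣                         ≤⟨ ℕP.*-monoʳ-≤ 2 (ℤP.∣i+j∣≤∣i∣+∣j∣ (x * a) (y * c)) ⟩
    2 ℕ.* (∣ x * a ∣ ℕ.+ ∣ y * c ∣)                 ≡⟨ cong₂ (λ p q → 2 ℕ.* (p ℕ.+ q)) (ℤP.abs-* x a) (ℤP.abs-* y c) ⟩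
    2 ℕ.* (∣ x ∣ ℕ.* ∣ a ∣ ℕ.+ ∣ y ∣ ℕ.* ∣ c ∣)     ≡⟨ distribute (∣ x ∣) (∣ a ∣) (∣ y ∣) (∣ c ∣) ⟩
    2 ℕ.* ∣ x ∣ ℕ.* ∣ a ∣ ℕ.+ 2 ℕ.* ∣ y ∣ ℕ.* ∣ c ∣ ≤⟨ ℕP.+-mono-≤ (ℕP.*-mono-≤ 2x≤D a≤m) (ℕP.*-mono-≤ 2y≤D c≤m) ⟩
    ∣ D ∣ ℕ.* m ℕ.+ ∣ D ∣ ℕ.* m                     ≡⟨ double (∣ D ∣ ℕ.* m) ⟩
    2 ℕ.* (∣ D ∣ ℕ.* m)                             ∎))
  where
  open ℕP.≤-Reasoning
  D-nonZero : ℕ.NonZero ∣ D ∣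
  D-nonZero = ℕ.≢-nonZero (D≢0 ∘ ℤP.∣i∣≡0⇒i≡0)
  distribute : ∀ p q r s → 2 ℕ.* (p ℕ.* q ℕ.+ r ℕ.* s) ≡ 2 ℕ.* p ℕ.* q ℕ.+ 2 ℕ.* r ℕ.* s
  distribute = NatSolver.solve-∀
  double : ∀ p → p ℕ.+ p ≡ 2 ℕ.* p
  double = NatSolver.solve-∀

abs-unit : ∀ n → Σ ℤ λ σ → ∣ σ ∣ ≡ 1 × + ∣ n ∣ ≡ σ * n
abs-unit (+ n) = + 1 , refl , sym (ℤP.*-identityˡ (+ n))
abs-unit -[1+ n ] = -[1+ 0 ] , refl , sym (ℤP.-1*i≡-i -[1+ n ])

-- Centred division: a = q·n + r with |r| ≤ |n|/2.  Starting from the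
-- ordinary remainder 0 ≤ r₀ < |n|, if r₀ > |n|/2 use r₀ - |n| instead.
centred-division : ∀ a n → n ≢ + 0 → Σ ℤ λ q → Σ ℤ λ r → a ≡ q * n + r × 2 ℕ.* ∣ r ∣ ℕ.≤ ∣ n ∣
centred-division a n n≢0 = choose (2 ℕ.* r₀ ℕ.≤? ∣ n ∣)
  where
  instance
    n-nonZero : ℤ.NonZero n
    n-nonZero = ℤ.≢-nonZero n≢0
  q₀ : ℤ
  q₀ = a ℤ./ n
  r₀ : ℕ
  r₀ = a ℤ.% n
  σ : ℤ
  σ = proj₁ (abs-unit n)
  t : ℕ
  t = ∣ n ∣ ℕ.∸ r₀
  r₀+t : r₀ ℕ.+ t ≡ ∣ n ∣
  r₀+t = ℕP.m+[n∸m]≡n (ℕP.<⇒≤ (n%d<d a n))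
  regroup : ∀ R T Q N σ → R + T ≡ σ * N → R + Q * N ≡ (Q + σ) * N + - T
  regroup R T Q N σ e = begin
    R + Q * N              ≡⟨ solve (R ∷ T ∷ Q ∷ N ∷ []) ⟩
    (R + T) - T + Q * N    ≡⟨ cong (λ z → z - T + Q * N) e ⟩
    σ * N - T + Q * N      ≡⟨ solve (σ ∷ T ∷ Q ∷ N ∷ []) ⟩
    (Q + σ) * N + - T      ∎
    where open ≡-Reasoning
  shifted : a ≡ (q₀ + σ) * n + - + t
  shifted = trans (a≡a%n+[a/n]*n a n) (regroup (+ r₀) (+ t) q₀ n σ
    (trans (sym (ℤP.pos-+ r₀ t)) (trans (cong +_ r₀+t) (proj₂ (proj₂ (abs-unit n))))))
  2t≤n : ¬ 2 ℕ.* r₀ ℕ.≤ ∣ n ∣ → 2 ℕ.* t ℕ.≤ ∣ n ∣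
  2t≤n large = subst₂ ℕ._≤_ (cong (t ℕ.+_) (sym (ℕP.+-identityʳ t))) (trans (ℕP.+-comm t r₀) r₀+t)
    (ℕP.+-monoʳ-≤ t (ℕP.<⇒≤ t<r₀))
    where
    t<r₀ : t ℕ.< r₀
    t<r₀ = ℕP.+-cancelˡ-< r₀ t r₀
      (subst₂ ℕ._<_ (sym r₀+t) (cong (r₀ ℕ.+_) (ℕP.+-identityʳ r₀)) (ℕP.≰⇒> large))
  choose : Dec (2 ℕ.* r₀ ℕ.≤ ∣ n ∣) → Σ ℤ λ q → Σ ℤ λ r → a ≡ q * n + r × 2 ℕ.* ∣ r ∣ ℕ.≤ ∣ n ∣
  choose (yes small) = q₀ , + r₀ , trans (a≡a%n+[a/n]*n a n) (ℤP.+-comm (+ r₀) (q₀ * n)) , small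
  choose (no large) = q₀ + σ , - + t , shifted ,
    subst (λ k → 2 ℕ.* k ℕ.≤ ∣ n ∣) (sym (ℤP.∣-i∣≡∣i∣ (+ t))) (2t≤n large)

ReducedPoint : ℤ → Vec2 → Vec2 → Set
ReducedPoint D w₁ w₂ = Σ Vec2 λ u → Σ ℤ λ x → Σ ℤ λ y →
  (D ·V u ≡ x ·V w₁ +V y ·V w₂) × 2 ℕ.* ∣ x ∣ ℕ.≤ ∣ D ∣ × 2 ℕ.* ∣ y ∣ ℕ.≤ ∣ D ∣ ×
  ¬ (x ≡ + 0 × y ≡ + 0)

BothMultiples : ℤ → ℤ → ℤ → Set
BothMultiples D p q = Σ ℤ λ s → Σ ℤ λ t → p ≡ s * D × q ≡ t * D

shift-relation : ∀ D v p q w₁ w₂ s t x y → D ·V v ≡ p ·V w₁ +V q ·V w₂ →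
  p ≡ s * D + x → q ≡ t * D + y → D ·V ((v -V (s ·V w₁)) -V (t ·V w₂)) ≡ x ·V w₁ +V y ·V w₂
shift-relation D (v₁ , v₂) p q (a , b) (c , d) s t x y eq p≡ q≡ =
  cong₂ _,_ (component v₁ a c (cong proj₁ eq)) (component v₂ b d (cong proj₂ eq))
  where
  component : ∀ v a c → D * v ≡ p * a + q * c → D * (v - s * a - t * c) ≡ x * a + y * c
  component v a c e = begin
    D * (v - s * a - t * c)                              ≡⟨ solve (D ∷ v ∷ s ∷ a ∷ t ∷ c ∷ []) ⟩
    D * v - s * D * a - t * D * c                        ≡⟨ cong (λ z → z - s * D * a - t * D * c) e ⟩
    p * a + q * c - s * D * a - t * D * c                ≡⟨ cong₂ (λ p q → p * a + q * c - s * D * a - t * D * c) p≡ q≡ ⟩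
    (s * D + x) * a + (t * D + y) * c - s * D * a - t * D * c ≡⟨ solve (s ∷ D ∷ x ∷ a ∷ t ∷ y ∷ c ∷ []) ⟩
    x * a + y * c                                        ∎
    where open ≡-Reasoning

reduce : ∀ D v p q w₁ w₂ → D ≢ + 0 → D ·V v ≡ p ·V w₁ +V q ·V w₂ →
  BothMultiples D p q ⊎ ReducedPoint D w₁ w₂
reduce D v p q w₁ w₂ D≢0 eq with centred-division p D D≢0 | centred-division q D D≢0
... | s , x , p≡ , 2x≤D | t , y , q≡ , 2y≤D with x ℤP.≟ + 0 | y ℤP.≟ + 0
...   | yes x≡0 | yes y≡0 = inj₁ (s , t ,
        trans p≡ (trans (cong (λ r → s * D + r) x≡0) (ℤP.+-identityʳ (s * D))) ,
        trans q≡ (trans (cong (λ r → t * D + r) y≡0) (ℤP.+-identityʳ (t * D))))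
...   | yes _ | no y≢0 = inj₂ (_ , x , y , shift-relation D v p q w₁ w₂ s t x y eq p≡ q≡ ,
                               2x≤D , 2y≤D , y≢0 ∘ proj₂)
...   | no x≢0 | _ = inj₂ (_ , x , y , shift-relation D v p q w₁ w₂ s t x y eq p≡ q≡ ,
                           2x≤D , 2y≤D , x≢0 ∘ proj₁)

2≤∣D∣⇒D≢0 : ∀ {D} → 2 ℕ.≤ ∣ D ∣ → D ≢ + 0
2≤∣D∣⇒D≢0 2≤∣D∣ D≡0 = ℕP.<⇒≱ 2≤∣D∣ (subst (ℕ._≤ 1) (sym (cong ∣_∣ D≡0)) ℕ.z≤n)

square-divides : ∀ D K → D ≡ D * (D * K) → ∣ D ∣ ℕ.≤ 1
square-divides D K eq with D ℤP.≟ + 0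
... | yes refl = ℕ.z≤n
... | no D≢0 = ℕP.≤-reflexive (ℕP.m*n≡1⇒m≡1 ∣ D ∣ ∣ K ∣ (trans (sym (ℤP.abs-* D K)) (cong ∣_∣ (sym DK≡1))))
  where
  DK≡1 : + 1 ≡ D * K
  DK≡1 = ℤP.*-cancelˡ-≡ D (+ 1) (D * K) {{ℤ.≢-nonZero D≢0}} (trans (ℤP.*-identityʳ D) eq)

entries-multiples : ∀ a b c d D s₁ t₁ s₂ t₂ → d ≡ s₁ * D → - b ≡ t₁ * D → - c ≡ s₂ * D → a ≡ t₂ * D →
  a * d - b * c ≡ D * (D * (t₂ * s₁ - t₁ * s₂))
entries-multiples a b c d D s₁ t₁ s₂ t₂ d≡ -b≡ -c≡ a≡ = begin
  a * d - b * c                              ≡⟨ solve (a ∷ b ∷ c ∷ d ∷ []) ⟩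
  a * d - (- b) * (- c)                      ≡⟨ cong₂ (λ p q → p - q) (cong₂ _*_ a≡ d≡) (cong₂ _*_ -b≡ -c≡) ⟩
  (t₂ * D) * (s₁ * D) - (t₁ * D) * (s₂ * D)  ≡⟨ solve (D ∷ s₁ ∷ t₁ ∷ s₂ ∷ t₂ ∷ []) ⟩
  D * (D * (t₂ * s₁ - t₁ * s₂))              ∎
  where open ≡-Reasoning

-- Rows with |det| ≥ 2 have a reduced point: reduce the adjugate relations
-- D·e₁ = d·w₁ - b·w₂ and D·e₂ = -c·w₁ + a·w₂ modulo D.  If all four
-- coefficients were multiples of D, then D² would divide D.
reduced-point : ∀ w₁ w₂ → 2 ℕ.≤ ∣ det (w₁ , w₂) ∣ → ReducedPoint (det (w₁ , w₂)) w₁ w₂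
reduced-point w₁@(a , b) w₂@(c , d) 2≤∣D∣ = from-e₁ (reduce D (+ 1 , + 0) d (- b) w₁ w₂ D≢0 adjugate₁)
  where
  D : ℤ
  D = a * d - b * c
  D≢0 : D ≢ + 0
  D≢0 = 2≤∣D∣⇒D≢0 2≤∣D∣
  adj-diag₁ : ∀ a b c d → (a * d - b * c) * + 1 ≡ d * a + (- b) * c
  adj-diag₁ = solve-∀
  adj-diag₂ : ∀ a b c d → (a * d - b * c) * + 1 ≡ (- c) * b + a * d
  adj-diag₂ = solve-∀
  adj-off₁ : ∀ p q → + 0 ≡ p * q + (- q) * p
  adj-off₁ = solve-∀
  adj-off₂ : ∀ p q → + 0 ≡ (- p) * q + q * p
  adj-off₂ = solve-∀
  adjugate₁ : D ·V (+ 1 , + 0) ≡ d ·V w₁ +V (- b) ·V w₂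
  adjugate₁ = cong₂ _,_ (adj-diag₁ a b c d) (trans (ℤP.*-zeroʳ D) (adj-off₁ d b))
  adjugate₂ : D ·V (+ 0 , + 1) ≡ (- c) ·V w₁ +V a ·V w₂
  adjugate₂ = cong₂ _,_ (trans (ℤP.*-zeroʳ D) (adj-off₂ c a)) (adj-diag₂ a b c d)
  from-e₂ : BothMultiples D d (- b) → BothMultiples D (- c) a ⊎ ReducedPoint D w₁ w₂ → ReducedPoint D w₁ w₂
  from-e₂ _ (inj₂ point) = point
  from-e₂ (s₁ , t₁ , d≡ , -b≡) (inj₁ (s₂ , t₂ , -c≡ , a≡)) =
    ⊥-elim (ℕP.<⇒≱ 2≤∣D∣ (square-divides D (t₂ * s₁ - t₁ * s₂) (entries-multiples a b c d D s₁ t₁ s₂ t₂ d≡ -b≡ -c≡ a≡)))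
  from-e₁ : BothMultiples D d (- b) ⊎ ReducedPoint D w₁ w₂ → ReducedPoint D w₁ w₂
  from-e₁ (inj₂ point) = point
  from-e₁ (inj₁ multiples) = from-e₂ multiples (reduce D (+ 0 , + 1) (- c) a w₁ w₂ D≢0 adjugate₂)

∣unit*∣ : ∀ s i → ∣ s ∣ ≡ 1 → ∣ s * i ∣ ≡ ∣ i ∣
∣unit*∣ s i us = trans (ℤP.abs-* s i) (trans (cong (ℕ._* ∣ i ∣) us) (ℕP.*-identityˡ ∣ i ∣))

∣*unit∣ : ∀ i s → ∣ s ∣ ≡ 1 → ∣ i * s ∣ ≡ ∣ i ∣
∣*unit∣ i s us = trans (cong ∣_∣ (ℤP.*-comm i s)) (∣unit*∣ s i us)

resign-relation : ∀ D u x y r₁ r₂ s s₁ s₂ → ∣ s ∣ ≡ 1 → ∣ s₁ ∣ ≡ 1 → ∣ s₂ ∣ ≡ 1 →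
  D ·V u ≡ x ·V (s₁ ·V r₁) +V y ·V (s₂ ·V r₂) →
  Σ ℤ λ X → Σ ℤ λ Y → (+ ∣ D ∣ ·V (s ·V u) ≡ X ·V r₁ +V Y ·V r₂) × ∣ X ∣ ≡ ∣ x ∣ × ∣ Y ∣ ≡ ∣ y ∣
resign-relation D (u₁ , u₂) x y (a₁ , b₁) (a₂ , b₂) s s₁ s₂ us us₁ us₂ eq with abs-unit D
... | σ , uσ , ∣D∣≡σD =
  σ * s * x * s₁ , σ * s * y * s₂ ,
  cong₂ _,_ (component u₁ a₁ a₂ (cong proj₁ eq)) (component u₂ b₁ b₂ (cong proj₂ eq)) ,
  trans (∣*unit∣ (σ * s * x) s₁ us₁) (∣unit*∣ (σ * s) x σs-unit) ,
  trans (∣*unit∣ (σ * s * y) s₂ us₂) (∣unit*∣ (σ * s) y σs-unit)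
  where
  σs-unit : ∣ σ * s ∣ ≡ 1
  σs-unit = trans (ℤP.abs-* σ s) (cong₂ ℕ._*_ uσ us)
  component : ∀ u a₁ a₂ → D * u ≡ x * (s₁ * a₁) + y * (s₂ * a₂) →
    + ∣ D ∣ * (s * u) ≡ σ * s * x * s₁ * a₁ + σ * s * y * s₂ * a₂
  component u a₁ a₂ e = begin
    + ∣ D ∣ * (s * u)                          ≡⟨ cong (_* (s * u)) ∣D∣≡σD ⟩
    σ * D * (s * u)                            ≡⟨ solve (σ ∷ D ∷ s ∷ u ∷ []) ⟩
    σ * s * (D * u)                            ≡⟨ cong ((σ * s) *_) e ⟩
    σ * s * (x * (s₁ * a₁) + y * (s₂ * a₂))    ≡⟨ solve (σ ∷ s ∷ x ∷ s₁ ∷ a₁ ∷ y ∷ s₂ ∷ a₂ ∷ []) ⟩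
    σ * s * x * s₁ * a₁ + σ * s * y * s₂ * a₂  ∎
    where open ≡-Reasoning

D≢0⇒0<∣D∣ : ∀ {D} → D ≢ + 0 → + 0 ℤ.< + ∣ D ∣
D≢0⇒0<∣D∣ D≢0 = ℤ.+<+ (ℕP.n≢0⇒n>0 (D≢0 ∘ ℤP.∣i∣≡0⇒i≡0))

twice-bound : ∀ X n → 2 ℕ.* ∣ X ∣ ℕ.≤ n → + 2 * X ℤ.≤ + n
twice-bound X n h = ℤP.≤-trans (ℤP.*-monoˡ-≤-nonNeg (+ 2) (i≤∣i∣ X))
  (subst (ℤ._≤ + n) (ℤP.pos-* 2 ∣ X ∣) (ℤ.+≤+ h))
  where
  i≤∣i∣ : ∀ i → i ℤ.≤ + ∣ i ∣
  i≤∣i∣ (+ n) = ℤP.≤-refl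
  i≤∣i∣ -[1+ n ] = ℤ.-≤+

reduced-point-bounded : ∀ D u x y w₁ w₂ m → D ≢ + 0 → D ·V u ≡ x ·V w₁ +V y ·V w₂ →
  2 ℕ.* ∣ x ∣ ℕ.≤ ∣ D ∣ → 2 ℕ.* ∣ y ∣ ℕ.≤ ∣ D ∣ → NormLe w₁ m → NormLe w₂ m → NormLe u m
reduced-point-bounded D (u₁ , u₂) x y (a , b) (c , d) m D≢0 eq 2x≤D 2y≤D (a≤m , b≤m) (c≤m , d≤m) =
  half-coefficients-bound D u₁ x y a c m D≢0 (cong proj₁ eq) 2x≤D 2y≤D a≤m c≤m ,
  half-coefficients-bound D u₂ x y b d m D≢0 (cong proj₂ eq) 2x≤D 2y≤D b≤m d≤m

module Unimodular (α : IrrationalIn01) where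
  open Magnitude α

  -- For independent w₁, w₂ with |ξ(w₁)| ≤ |ξ(w₂)| the inequality is
  -- strict: equal magnitudes would make w₁ = ±w₂.
  AbsLe-strict : ∀ {w₁ w₂ r₁ r₂} → LinIndep w₁ w₂ → AbsLe α w₁ w₂ →
    IsAbs α w₁ r₁ → IsAbs α w₂ r₂ → ξPos α (r₂ -V r₁)
  AbsLe-strict {w₁} {w₂} {r₁} {r₂} ind le A₁ A₂ with ξPos-trichotomy (r₂ -V r₁)
  ... | inj₁ p = p
  ... | inj₂ (inj₁ p) = ⊥-elim (le (AbsLt-intro A₂ A₁ (subst (ξPos α) (negV-diff r₂ r₁) p)))
  ... | inj₂ (inj₂ r₂-r₁≡0) with IsAbs-sign A₁ | IsAbs-sign A₂
  ...   | s₁ , _ , w₁≡s₁r₁ , _ | s₂ , _ , _ , r₂≡s₂w₂ =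
    ⊥-elim (LinIndep⇒¬multipleˡ w₁ w₂ (s₁ * s₂) ind (begin
      w₁               ≡⟨ w₁≡s₁r₁ ⟩
      s₁ ·V r₁         ≡⟨ cong (s₁ ·V_) (sym (diff≡0 r₂ r₁ r₂-r₁≡0)) ⟩
      s₁ ·V r₂         ≡⟨ cong (s₁ ·V_) r₂≡s₂w₂ ⟩
      s₁ ·V s₂ ·V w₂   ≡⟨ ·V-assoc s₁ s₂ w₂ ⟩
      (s₁ * s₂) ·V w₂  ∎))
    where open ≡-Reasoning

  magnitude-relation : ∀ {D u x y w₁ w₂ r r₁ r₂} → IsAbs α u r → IsAbs α w₁ r₁ → IsAbs α w₂ r₂ →
    D ·V u ≡ x ·V w₁ +V y ·V w₂ →
    Σ ℤ λ X → Σ ℤ λ Y → (+ ∣ D ∣ ·V r ≡ X ·V r₁ +V Y ·V r₂) × ∣ X ∣ ≡ ∣ x ∣ × ∣ Y ∣ ≡ ∣ y ∣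
  magnitude-relation {D} {u} {x} {y} {r₁ = r₁} {r₂} A A₁ A₂ eq
    with IsAbs-sign A | IsAbs-sign A₁ | IsAbs-sign A₂
  ... | s , us , _ , refl | s₁ , us₁ , refl , _ | s₂ , us₂ , refl , _ =
    resign-relation D u x y r₁ r₂ s s₁ s₂ us us₁ us₂ eq

  reduced-point-smaller : ∀ {D u x y w₁ w₂ r₁ r₂} → D ≢ + 0 → D ·V u ≡ x ·V w₁ +V y ·V w₂ →
    2 ℕ.* ∣ x ∣ ℕ.≤ ∣ D ∣ → 2 ℕ.* ∣ y ∣ ℕ.≤ ∣ D ∣ → IsAbs α w₁ r₁ → IsAbs α w₂ r₂ →
    ξPos α r₁ → ξPos α (r₂ -V r₁) → AbsLt α u w₂ × (y ≡ + 0 → AbsLt α u w₁)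
  reduced-point-smaller {D} {u} {x} {y} {w₁} {w₂} {r₁} {r₂} D≢0 eq 2x≤D 2y≤D A₁ A₂ p₁ p₂₁
    with IsAbs-exists u
  ... | r , A with magnitude-relation {D} {u} {x} {y} A A₁ A₂ eq
  ...   | X , Y , rel , ∣X∣≡ , ∣Y∣≡ =
    AbsLt-intro {u} {w₂} A A₂ (below-larger E X Y r₁ r₂ r 0<E 2X≤E 2Y≤E rel p₁ p₂₁) ,
    λ y≡0 → AbsLt-intro {u} {w₁} A A₁ (below-half E X r₁ r₂ r 0<E 2X≤E (subst (λ Z → E ·V r ≡ X ·V r₁ +V Z ·V r₂) (Y≡0 y≡0) rel) p₁)
    where
    E : ℤ
    E = + ∣ D ∣
    0<E : + 0 ℤ.< E
    0<E = D≢0⇒0<∣D∣ D≢0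
    2X≤E : + 2 * X ℤ.≤ E
    2X≤E = twice-bound X ∣ D ∣ (subst (λ k → 2 ℕ.* k ℕ.≤ ∣ D ∣) (sym ∣X∣≡) 2x≤D)
    2Y≤E : + 2 * Y ℤ.≤ E
    2Y≤E = twice-bound Y ∣ D ∣ (subst (λ k → 2 ℕ.* k ℕ.≤ ∣ D ∣) (sym ∣Y∣≡) 2y≤D)
    Y≡0 : y ≡ + 0 → Y ≡ + 0
    Y≡0 y≡0 = ℤP.∣i∣≡0⇒i≡0 (trans ∣Y∣≡ (cong ∣_∣ y≡0))

  -- No A_m has |det| ≥ 2: a reduced point u of its rows lies in the box
  -- ‖·‖∞ ≤ m and beats w₁ (if y = 0, where u ≠ 0) or w₂ (if y ≠ 0, where u
  -- is independent of w₁), against the minimality defining A_m.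
  no-large-det : ∀ m w₁ w₂ → IsA α m (w₁ , w₂) → ¬ 2 ℕ.≤ ∣ det (w₁ , w₂) ∣
  no-large-det m w₁ w₂ ((w₁≢0 , w₁≤m , _ , min₁) , (ind , w₂≤m , _ , min₂)) 2≤∣D∣ =
    refute (reduced-point w₁ w₂ 2≤∣D∣) (IsAbs-exists w₁) (IsAbs-exists w₂)
    where
    D : ℤ
    D = det (w₁ , w₂)
    D≢0 : D ≢ + 0
    D≢0 = 2≤∣D∣⇒D≢0 2≤∣D∣
    refute : ReducedPoint D w₁ w₂ → Σ Vec2 (IsAbs α w₁) → Σ Vec2 (IsAbs α w₂) → ⊥
    refute (u , x , y , Du , 2x≤D , 2y≤D , xy≢0) (r₁ , A₁) (r₂ , A₂) = by-cases (y ℤP.≟ + 0)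
      where
      u≤m : NormLe u m
      u≤m = reduced-point-bounded D u x y w₁ w₂ m D≢0 Du 2x≤D 2y≤D w₁≤m w₂≤m
      w₁<w₂ : ξPos α (r₂ -V r₁)
      w₁<w₂ = AbsLe-strict ind (min₁ w₂ (LinIndep⇒nonzeroʳ w₁ w₂ ind) w₂≤m) A₁ A₂
      u-smaller : AbsLt α u w₂ × (y ≡ + 0 → AbsLt α u w₁)
      u-smaller = reduced-point-smaller {D} {u} {x} {y} {w₁} {w₂} D≢0 Du 2x≤D 2y≤D A₁ A₂ (IsAbs-pos A₁ w₁≢0) w₁<w₂
      by-cases : Dec (y ≡ + 0) → ⊥
      by-cases (yes y≡0) =
        min₁ u (combination-nonzero D u x w₁ w₂ w₁≢0 (λ x≡0 → xy≢0 (x≡0 , y≡0))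
                 (subst (λ z → D ·V u ≡ x ·V w₁ +V z ·V w₂) y≡0 Du))
             u≤m (proj₂ u-smaller y≡0)
      by-cases (no y≢0) = min₂ u (combination-indep D u x y w₁ w₂ D≢0 y≢0 Du ind) u≤m (proj₁ u-smaller)

  unimodular : ∀ m M → IsA α m M → ∣ det M ∣ ≡ 1
  unimodular m (w₁ , w₂) isA with ∣ det (w₁ , w₂) ∣ in ∣D∣≡
  ... | 0 = ⊥-elim (LinIndep⇒det≢0 w₁ w₂ (proj₁ (proj₂ isA)) (ℤP.∣i∣≡0⇒i≡0 ∣D∣≡))
  ... | 1 = refl
  ... | suc (suc k) = ⊥-elim (no-large-det m w₁ w₂ isA (subst (2 ℕ.≤_) (sym ∣D∣≡) (ℕ.s≤s (ℕ.s≤s ℕ.z≤n))))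

corollary1 : (α : IrrationalIn01) (A : ℕ → Mat2) →
    (∀ m → 1 ℕ.≤ m → IsA α m (A m)) →
    (B : ℕ → Mat2) → IsChainOf A B →
    ∀ k → ℤ.∣ det (B k) ∣ ≡ 1
corollary1 α A isA B (s , s₀≡1 , s-increasing , B≡A∘s , _ , _) k =
  subst (λ M → ∣ det M ∣ ≡ 1) (sym (B≡A∘s k)) (Unimodular.unimodular α (s k) (A (s k)) (isA (s k) (1≤s k)))
  where
  1≤s : ∀ k → 1 ℕ.≤ s k
  1≤s zero = ℕP.≤-reflexive (sym s₀≡1)
  1≤s (suc k) = ℕP.≤-trans (1≤s k) (ℕP.<⇒≤ (s-increasing k))
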